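{- Let $\mathcal{GO}=\langle t,\prec,\phi\rangle$ be a GOMT problem with $\phi$ satisfiable, and let $\mathcal{S}=\langle\mathcal{I},\Delta,\tau\rangle$ and $\mathcal{S}'=\langle\mathcal{I}',\Delta',\tau'\rangle$ be states such that $\mathcal{S}$ occurs in a $\mathcal{GO}$-derivation and $\mathcal{S}'$ is the result of applying the rule F-Sat to $\mathcal{S}$. Then $\mathcal{I}'<_{\mathcal{GO}}\mathcal{I}$.
   Context: Fix a many-sorted first-order theory $\mathcal{T}$ with signature $\Sigma$; interpretations are $\mathcal{T}$-interpretations assigning values to all variables, and $\models$ means $\models_{\mathcal{T}}$. A GOMT problem is $\mathcal{GO}=\langle t,\prec,\phi\rangle$: $t$ a $\Sigma$-term of sort $\sigma$, $\prec$ a strict partial order on values of sort $\sigma$ definable in $\mathcal{T}$, $\phi$ a $\Sigma$-formula. $\mathcal{I}$ is $\mathcal{GO}$-consistent if $\mathcal{I}\models\phi$; $\mathcal{I}<_{\mathcal{GO}}\mathcal{I}'$ if both are $\mathcal{GO}$-consistent and $t^{\mathcal{I}}\prec t^{\mathcal{I}'}$. $\textsc{Solve}$ maps a formula to an interpretation satisfying it if satisfiable, else to $\bot$. $\textsc{Better}$ maps each $\mathcal{GO}$-consistent $\mathcal{I}$ to a formula with: for every $\mathcal{GO}$-consistent $\mathcal{I}'$, $\mathcal{I}'\models\textsc{Better}(\mathcal{I})$ iff $\mathcal{I}'<_{\mathcal{GO}}\mathcal{I}$. $\textsc{Top}(s_1,\dots,s_n)=s_1$, $\textsc{Pop}(s_1,\dots,s_n)=(s_2,\dots,s_n)$,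 $\emptyset$ the empty sequence, $\circ$ concatenation. A state is $\langle\mathcal{I},\Delta,\tau\rangle$ (interpretation, formula, finite sequence of formulas). Initial state: $\mathcal{I}_0=\textsc{Solve}(\phi)$, $\Delta_0=\textsc{Better}(\mathcal{I}_0)$, $\tau_0=(\Delta_0)$. Rules (unmentioned components unchanged): F-Split: if $\tau\neq\emptyset$, $\psi=\textsc{Top}(\tau)$, $\phi\models\psi\Leftrightarrow\bigvee_{j=1}^k\psi_j$, $k\ge1$, then $\tau:=(\psi_1,\dots,\psi_k)\circ\textsc{Pop}(\tau)$. F-Sat: if $\tau\neq\emptyset$, $\psi=\textsc{Top}(\tau)$, $\textsc{Solve}(\phi\wedge\psi)=\mathcal{I}'\neq\bot$, $\Delta'=\Delta\wedge\textsc{Better}(\mathcal{I}')$, then $\mathcal{I}:=\mathcal{I}'$, $\Delta:=\Delta'$, $\tau:=(\Delta')$. F-Close: if $\tau\neq\emptyset$, $\psi=\textsc{Top}(\tau)$, $\textsc{Solve}(\phi\wedge\psi)=\bot$, then $\Delta:=\Delta\wedge\neg\psi$, $\tau:=\textsc{Pop}(\tau)$. A rule applies if its premises hold and the resulting state differs. A $\mathcal{GO}$-derivation is a sequence of states starting at the initial state, each obtained from the previous by one rule. -}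

module Defs where

open import Data.Product using (Σ; ∃; _×_; _,_)
open import Data.Maybe using (Maybe; just; nothing)
open import Data.List using (List; []; _∷_; _++_)
open import Data.List.Relation.Unary.Any using (Any)
open import Data.Nat using (ℕ; _≥_)
open import Data.List using (length)
open import Relation.Nullary using (¬_)
open import Relation.Binary.PropositionalEquality using (_≡_)
open import Relation.Binary.Structures using (IsStrictPartialOrder)
open import Function.Bundles using (_⇔_)

-- A (many-sorted, first-order) theory T, presented semantically:
-- the class of T-interpretations (assigning values to all variables),
-- the Σ-formulas, satisfaction ⊨_T, and the connectives used by the
-- calculus (conjunction and negation) with their Tarskian semantics.

record Theory : Set₁ where
  infix 4 _⊨_
  infixr 6 _∧_
  field
    Interp  : Set
    Formula : Set
    _⊨_     : Interp → Formula → Set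
    _∧_     : Formula → Formula → Formula
    ~_      : Formula → Formula
    ⊨-∧     : ∀ I ψ χ → (I ⊨ ψ ∧ χ) ⇔ ((I ⊨ ψ) × (I ⊨ χ))
    ⊨-~     : ∀ I ψ → (I ⊨ ~ ψ) ⇔ (¬ (I ⊨ ψ))

  Satisfiable : Formula → Set
  Satisfiable ψ = ∃ λ I → I ⊨ ψ

-- A GOMT problem ⟨t, ≺, φ⟩ over T.  The term t (of sort σ) is given
-- through its value t^I in each interpretation; ≺ is a strict partial
-- order on the values of sort σ.

record GOMT (T : Theory) : Set₁ where
  open Theory T
  field
    Val    : Set
    ⟦t⟧    : Interp → Val
    _≺_    : Val → Val → Set
    ≺-spo  : IsStrictPartialOrder _≡_ _≺_
    φ      : Formula

  Consistent : Interp → Set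
  Consistent I = I ⊨ φ

  _<GO_ : Interp → Interp → Set
  I <GO I' = Consistent I × Consistent I' × (⟦t⟧ I ≺ ⟦t⟧ I')

-- The oracles Solve and Better with their specifications.
-- Better is a total function whose specification only constrains its
-- value on GO-consistent interpretations.

record Oracles {T : Theory} (GO : GOMT T) : Set where
  open Theory T
  open GOMT GO
  field
    Solve       : Formula → Maybe Interp
    Solve-just  : ∀ ψ I → Solve ψ ≡ just I → I ⊨ ψ
    Solve-nothing : ∀ ψ → Solve ψ ≡ nothing → ¬ Satisfiable ψ
    Better      : Interp → Formula
    Better-spec : ∀ I → Consistent I → ∀ I' → Consistent I' →
                  (I' ⊨ Better I) ⇔ (I' <GO I)

module Calculus {T : Theory} (GO : GOMT T) (O : Oracles GO) where
  open Theory T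
  open GOMT GO
  open Oracles O

  record State : Set where
    constructor ⟨_,_,_⟩
    field
      interp : Interp
      Δ      : Formula
      τ      : List Formula

  data FSplit : State → State → Set where
    fsplit : ∀ I Δ ψ rest (ψs : List Formula) →
             length ψs ≥ 1 →
             (∀ J → J ⊨ φ → (J ⊨ ψ) ⇔ Any (J ⊨_) ψs) →
             ¬ (⟨ I , Δ , ψ ∷ rest ⟩ ≡ ⟨ I , Δ , ψs ++ rest ⟩) →
             FSplit ⟨ I , Δ , ψ ∷ rest ⟩ ⟨ I , Δ , ψs ++ rest ⟩

  data FSat : State → State → Set where
    fsat : ∀ I Δ ψ rest I' →
           Solve (φ ∧ ψ) ≡ just I' →
           ¬ (⟨ I , Δ , ψ ∷ rest ⟩ ≡ ⟨ I' , Δ ∧ Better I' , Δ ∧ Better I' ∷ [] ⟩) →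
           FSat ⟨ I , Δ , ψ ∷ rest ⟩ ⟨ I' , Δ ∧ Better I' , Δ ∧ Better I' ∷ [] ⟩

  data FClose : State → State → Set where
    fclose : ∀ I Δ ψ rest →
             Solve (φ ∧ ψ) ≡ nothing →
             ¬ (⟨ I , Δ , ψ ∷ rest ⟩ ≡ ⟨ I , Δ ∧ ~ ψ , rest ⟩) →
             FClose ⟨ I , Δ , ψ ∷ rest ⟩ ⟨ I , Δ ∧ ~ ψ , rest ⟩

  data Step (S S' : State) : Set where
    split : FSplit S S' → Step S S'
    sat   : FSat S S'   → Step S S'
    close : FClose S S' → Step S S'

  data Initial : State → Set where
    initial : ∀ I₀ → Solve φ ≡ just I₀ →
              Initial ⟨ I₀ , Better I₀ , Better I₀ ∷ [] ⟩

  data Reachable : State → Set where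
    start : ∀ {S} → Initial S → Reachable S
    step  : ∀ {S S'} → Reachable S → Step S S' → Reachable S'

-- Invariant: the current interpretation is φ-consistent, and every formula
-- on the stack τ is satisfied by φ-models only if they are strictly better
-- than the current interpretation.  Better establishes this for a singleton
-- stack, F-Split preserves it since the disjuncts cover exactly the models of
-- the split formula, and F-Close only pops.  F-Sat picks a φ-model of the top
-- of the stack, which by the invariant is strictly better.
module Submission where

open import Defs
open import Data.Product using (_×_; _,_; proj₁; proj₂)
open import Data.List using (List; []; _∷_)
open import Data.List.Relation.Unary.Any using (Any; here; there)
open import Data.List.Relation.Unary.All using (All; []; _∷_)
open import Data.List.Relation.Unary.All.Properties using (++⁺)
open import Data.Maybe using (just)
open import Function.Bundles using (Equivalence)
open import Relation.Binary.PropositionalEquality using (_≡_)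

module FSatImproves (T : Theory) (GO : GOMT T) (O : Oracles GO) where
  open Theory T
  open GOMT GO
  open Oracles O
  open Calculus GO O
  open Equivalence using (to; from)

  ImprovesOn : Interp → Formula → Set
  ImprovesOn I ψ = ∀ J → J ⊨ φ → J ⊨ ψ → J <GO I

  Invariant : State → Set
  Invariant ⟨ I , _ , τ ⟩ = Consistent I × All (ImprovesOn I) τ

  Better-improvesOn : ∀ I → Consistent I → ImprovesOn I (Better I)
  Better-improvesOn I I⊨φ J J⊨φ = to (Better-spec I I⊨φ J J⊨φ)

  ∧-improvesOn : ∀ I Δ → Consistent I → ImprovesOn I (Δ ∧ Better I)
  ∧-improvesOn I Δ I⊨φ J J⊨φ J⊨Δ∧B =
    Better-improvesOn I I⊨φ J J⊨φ (proj₂ (to (⊨-∧ J Δ (Better I)) J⊨Δ∧B))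

  improvesOn-any : ∀ I (ψs : List Formula) →
                   (∀ J → J ⊨ φ → Any (J ⊨_) ψs → J <GO I) →
                   All (ImprovesOn I) ψs
  improvesOn-any I []       _   = []
  improvesOn-any I (ψ ∷ ψs) any =
    (λ J J⊨φ J⊨ψ → any J J⊨φ (here J⊨ψ)) ∷
    improvesOn-any I ψs (λ J J⊨φ J⊨ψs → any J J⊨φ (there J⊨ψs))

  Solve-φ∧-sound : ∀ ψ I → Solve (φ ∧ ψ) ≡ just I → I ⊨ φ × I ⊨ ψ
  Solve-φ∧-sound ψ I eq = to (⊨-∧ I φ ψ) (Solve-just (φ ∧ ψ) I eq)

  invariant : ∀ {S} → Reachable S → Invariant S
  invariant (start (initial I₀ eq)) =
    I₀⊨φ , Better-improvesOn I₀ I₀⊨φ ∷ []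
    where I₀⊨φ = Solve-just φ I₀ eq
  invariant (step r (split (fsplit I Δ ψ rest ψs _ ψ⇔ψs _))) with invariant r
  ... | I⊨φ , ψ-improves ∷ rest-improve =
    I⊨φ , ++⁺ (improvesOn-any I ψs λ J J⊨φ J⊨ψs → ψ-improves J J⊨φ (from (ψ⇔ψs J J⊨φ) J⊨ψs))
              rest-improve
  invariant (step r (sat (fsat I Δ ψ rest I' eq _))) =
    I'⊨φ , ∧-improvesOn I' Δ I'⊨φ ∷ []
    where I'⊨φ = proj₁ (Solve-φ∧-sound ψ I' eq)
  invariant (step r (close (fclose I Δ ψ rest eq _))) with invariant r
  ... | I⊨φ , _ ∷ rest-improve = I⊨φ , rest-improve

  fsat-improves : ∀ {S S'} → Reachable S → FSat S S' → State.interp S' <GO State.interp S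
  fsat-improves r (fsat I Δ ψ rest I' eq _) with invariant r
  ... | _ , ψ-improves ∷ _ with Solve-φ∧-sound ψ I' eq
  ...   | I'⊨φ , I'⊨ψ = ψ-improves I' I'⊨φ I'⊨ψ

lemma6 : (T : Theory) (GO : GOMT T) (O : Oracles GO) →
           Theory.Satisfiable T (GOMT.φ GO) →
           let open Calculus GO O
               open GOMT GO
           in ∀ (S S' : State) →
              Reachable S →
              FSat S S' →
              State.interp S' <GO State.interp S
lemma6 T GO O _ _ _ = FSatImproves.fsat-improves T GO O
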